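{- Let $n\ge1$, let $\lambda$ be a partition with at most $n$ parts and $N=n+\lambda_1$. Consider the admissible states of the six-vertex system $\mathfrak{S}^\Gamma_{\lambda,t}$ (context). Then: (1) The map sending an admissible state to the array whose $i$-th row ($1\le i\le n$) lists, in decreasing order, the column indices $j$ for which the vertical edge directly above vertex $(i,j)$ carries spin $-$, is a bijection from the set of admissible states onto the set of strict Gelfand–Tsetlin patterns with top row $\lambda+\rho=(\lambda_1+n,\lambda_2+n-1,\dots,\lambda_n+1)$. (2) The map sending a strict Gelfand–Tsetlin pattern with top row $\lambda+\rho$ to the filling whose column $c$ ($1\le c\le n+1$) consists of the elements of $\{1,\dots,N\}$ not occurring in row $n+2-c$ of the pattern (row $n+1$ being empty), written in increasing order from bottom to top, is a bijection onto the set of staircases whose rightmost column consists of the integers in $\{1,\dots,N\}$ not in $\lambda+\rho$.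
   Context: Grid: $n$ rows numbered $1,\dots,n$ top to bottom, $N$ columns numbered $1,\dots,N$ right to left; vertex $(i,j)$ in row $i$, column $j$; each vertex has left, top, right, bottom edges, shared between neighbours, with boundary edges at the ends of each row and column. A state assigns $\pm$ to every edge with left and bottom boundary edges $+$, right boundary edges $-$, and the top boundary edge of column $j$ equal to $-$ iff $j=\lambda_k+n-k+1$ for some $k$. A state is admissible if at every vertex the spins (left, top, right, bottom) are one of $(+,+,+,+)$, $(-,-,-,-)$, $(+,-,+,-)$, $(-,+,-,+)$, $(-,+,+,-)$, $(+,-,-,+)$. A Gelfand–Tsetlin pattern is a triangular array $(p_{ik})_{1\le i\le k\le n}$ of integers whose $i$-th row is $(p_{ii},p_{i,i+1},\dots,p_{in})$, with interleaving $p_{i-1,k-1}\ge p_{ik}\ge p_{i-1,k}$; it is strict if $p_{ii}>p_{i,i+1}>\dots>p_{in}$ for each $i$; its top row is its first row. A staircase is a semistandard Young tableau, written in French notation (rows weakly increasing left to right, columns strictly increasing bottom to top), with $n+1$ columns of lengths $\lambda_1+n,\lambda_1+n-1,\dots,\lambda_1$ (column $c$ of length $\lambda_1+n+1-c$), entries in $\{1,\dots,\lambda_1+n\}$, and with the additional condition that entries weakly decrease along each diagonal in the south-east direction (the entry in row $r$ (counted from the bottom), column $c$ is $\ge$ the entry in row $r-1$, column $c+1$ whenever both exist). -}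

module Defs where

open import Data.Nat using (ℕ; zero; suc; _+_; _∸_; _≤_; _<_)
open import Data.Integer using (ℤ; +_) renaming (_≤_ to _≤ℤ_; _>_ to _>ℤ_; _≟_ to _≟ℤ_)
open import Data.Fin using (Fin; toℕ; fromℕ; inject₁) renaming (zero to fz; suc to fs)
open import Data.Vec using (Vec; []; _∷_; lookup; tabulate; toList; init)
import Data.List as L
open L using (List; []; _∷_; reverse; map; filter; length; upTo)
open import Data.List.Relation.Unary.All using (All)
open import Data.List.Relation.Unary.Linked using (Linked)
open import Data.List.Membership.Propositional using (_∈_; _∉_)
open import Data.List.Membership.DecPropositional _≟ℤ_ using (_∈?_)
open import Data.Maybe using (Maybe; just; nothing)
open import Data.Product using (_×_; Σ; ∃; _,_)
open import Relation.Binary.PropositionalEquality using (_≡_)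
open import Relation.Nullary using (¬_; ¬?)


record BijectionOnto {A B : Set} (P : A → Set) (Q : B → Set) (f : A → B) : Set where
  field
    mapsTo     : ∀ a → P a → Q (f a)
    injective  : ∀ a a' → P a → P a' → f a ≡ f a' → a ≡ a'
    surjective : ∀ b → Q b → ∃ λ a → P a × f a ≡ b

-- λ₁ (0 for the empty vector)
first : ∀ {n} → Vec ℕ n → ℕ
first []      = 0
first (x ∷ _) = x

-- λ₁ ≥ λ₂ ≥ … ≥ λₙ ≥ 0  (entry k-1 of the vector is λ_k)
IsPartition : ∀ {n} → Vec ℕ n → Set
IsPartition {n} lam = (i j : Fin n) → toℕ i ≤ toℕ j → lookup lam j ≤ lookup lam i

-- λ + ρ = (λ₁ + n, λ₂ + n - 1, …, λₙ + 1); entry k (0-based) is λ_{k+1} + n - k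
lamRho : ∀ {n} → Vec ℕ n → List ℕ
lamRho {n} lam = toList (tabulate (λ k → lookup lam k + (n ∸ toℕ k)))

lamRhoℤ : ∀ {n} → Vec ℕ n → List ℤ
lamRhoℤ lam = map +_ (lamRho lam)

data Spin : Set where
  plus minus : Spin

-- State on n rows and N columns.
--  hor[i][k] (i : Fin n = row i+1, k : Fin (N+1)) is the horizontal edge in
--    row i+1 between column k+1 (on its left) and column k (on its right);
--    k = 0 is the right boundary edge, k = N the left boundary edge
--    (columns are numbered 1..N from right to left).
--  ver[k][c] (k : Fin (n+1), c : Fin N = column c+1) is the vertical edge
--    in column c+1 directly above row k+1; k = 0 is the top boundary edge,
--    k = n the bottom boundary edge.
record State (n N : ℕ) : Set where
  constructor mkState
  field
    hor : Vec (Vec Spin (suc N)) n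
    ver : Vec (Vec Spin N) (suc n)
open State public

-- allowed vertex configurations (left, top, right, bottom)
data Allowed : Spin → Spin → Spin → Spin → Set where
  a1 : Allowed plus  plus  plus  plus
  a2 : Allowed minus minus minus minus
  b1 : Allowed plus  minus plus  minus
  b2 : Allowed minus plus  minus plus
  c1 : Allowed minus plus  plus  minus
  c2 : Allowed plus  minus minus plus

module _ {n N : ℕ} (s : State n N) where
  -- edges around vertex (i+1, j+1)
  leftE rightE topE bottomE : Fin n → Fin N → Spin
  leftE   i j = lookup (lookup (hor s) i) (fs j)
  rightE  i j = lookup (lookup (hor s) i) (inject₁ j)
  topE    i j = lookup (lookup (ver s) (inject₁ i)) j
  bottomE i j = lookup (lookup (ver s) (fs i)) j

record Admissible {n : ℕ} (lam : Vec ℕ n) (s : State n (n + first lam)) : Set where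
  field
    vertices   : ∀ i j → Allowed (leftE s i j) (topE s i j) (rightE s i j) (bottomE s i j)
    leftBdry   : ∀ i → lookup (lookup (hor s) i) (fromℕ (n + first lam)) ≡ plus
    rightBdry  : ∀ i → lookup (lookup (hor s) i) fz ≡ minus
    bottomBdry : ∀ j → lookup (lookup (ver s) (fromℕ n)) j ≡ plus
    topBdry    : ∀ j → (lookup (lookup (ver s) fz) j ≡ minus → suc (toℕ j) ∈ lamRho lam)
                     × (suc (toℕ j) ∈ lamRho lam → lookup (lookup (ver s) fz) j ≡ minus)

-- Gelfand–Tsetlin patterns, as the list of their rows (row 1 first)

data Interleave : List ℤ → List ℤ → Set where
  one  : ∀ {a} → Interleave (a ∷ []) []
  more : ∀ {a a' b as bs} → b ≤ℤ a → a' ≤ℤ b → Interleave (a' ∷ as) bs →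
         Interleave (a ∷ a' ∷ as) (b ∷ bs)

data GTRows : List (List ℤ) → Set where
  lastRow : ∀ {a} → GTRows ((a ∷ []) ∷ [])
  step    : ∀ {r r' rs} → Interleave r r' → GTRows (r' ∷ rs) → GTRows (r ∷ r' ∷ rs)

IsStrictGTTop : List ℤ → List (List ℤ) → Set
IsStrictGTTop top p =
  GTRows p × All (Linked _>ℤ_) p × Σ (List (List ℤ)) (λ rest → p ≡ top ∷ rest)

colsUp : ∀ {m} → ℕ → Vec Spin m → List ℕ
colsUp k []          = []
colsUp k (plus ∷ v)  = colsUp (suc k) v
colsUp k (minus ∷ v) = k ∷ colsUp (suc k) v

colsDesc : ∀ {m} → Vec Spin m → List ℤ
colsDesc v = map +_ (reverse (colsUp 1 v))

gtOfState : ∀ {n N} → State n N → List (List ℤ)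
gtOfState s = toList (Data.Vec.map colsDesc (init (ver s)))

-- Staircases, as the list of their columns (left to right), each column
-- listed bottom to top (French notation)

nth : ∀ {A : Set} → List A → ℕ → Maybe A
nth []       _       = nothing
nth (x ∷ _)  zero    = just x
nth (_ ∷ xs) (suc k) = nth xs k

-- entry in row r (0-based from bottom), column c (0-based from left)
entry : List (List ℕ) → ℕ → ℕ → Maybe ℕ
entry T r c with nth T c
... | nothing  = nothing
... | just col = nth col r

record IsStaircase (n lam1 : ℕ) (T : List (List ℕ)) : Set where
  field
    numCols   : length T ≡ suc n
    colLen    : ∀ (c : ℕ) col → nth T c ≡ just col → length col ≡ (lam1 + n) ∸ c
    range     : ∀ r c x → entry T r c ≡ just x → 1 ≤ x × x ≤ lam1 + n
    rowWeak   : ∀ r c x y → entry T r c ≡ just x → entry T r (suc c) ≡ just y → x ≤ y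
    colStrict : ∀ r c x y → entry T r c ≡ just x → entry T (suc r) c ≡ just y → x < y
    diagonal  : ∀ r c x y → entry T (suc r) c ≡ just x → entry T r (suc c) ≡ just y → y ≤ x

IsStaircaseRC : ∀ {n} → Vec ℕ n → List (List ℕ) → Set
IsStaircaseRC {n} lam T =
  IsStaircase n (first lam) T ×
  Σ (List ℕ) (λ col → nth T n ≡ just col ×
    (∀ x → (x ∈ col → 1 ≤ x × x ≤ n + first lam × x ∉ lamRho lam)
         × (1 ≤ x × x ≤ n + first lam × x ∉ lamRho lam → x ∈ col)))

compl : ℕ → List ℤ → List ℕ
compl N r = filter (λ x → ¬? ((+ x) ∈? r)) (map suc (upTo N))

-- column c (1 ≤ c ≤ n+1) = complement of row n+2-c (row n+1 empty)
fillingOf : ℕ → List (List ℤ) → List (List ℕ)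
fillingOf N p = map (compl N) ([] ∷ reverse p)

module Submission where

-- Everything rests on one row lemma: along a row of vertices the horizontal spins are
-- forced from right to left by the vertical ones, and with − at the right end and + at
-- the left end the row is admissible iff the − columns above and below it alternate,
-- x₀ ≤ y₀ ≤ x₁ ≤ … ≤ xₖ, i.e. iff the corresponding GT rows interleave.  Turning a row
-- upside down while reversing its vertical spins permutes the six vertex types, so then
-- the + columns below and above alternate too: complements of interleaving rows are
-- alternating columns.

open import Defs
open import Data.Nat using (ℕ; zero; suc; _+_; _∸_; _≤_; _<_; z≤n; s≤s; _≟_)
open import Data.Nat.Properties
  using ( ≤-refl; ≤-reflexive; ≤-trans; <⇒≤; <-irrefl; <-trans; n≤1+n; m≤m+n; m≤n+m; +-comm; +-suc
        ; +-identityʳ; suc-injective; +-mono-≤; +-mono-≤-<; +-cancelʳ-≡; m∸n≤m; ∸-monoʳ-<; m<n⇒0<n∸m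
        ; ∸-+-assoc; +-∸-assoc )
open import Data.Integer using (ℤ; +_; +≤+; +<+) renaming (_≤_ to _≤ℤ_; _>_ to _>ℤ_; _≟_ to _≟ℤ_)
import Data.Integer.Properties as ℤ
open import Data.Fin using (Fin; toℕ; fromℕ; fromℕ<; inject₁) renaming (zero to fz; suc to fs)
open import Data.Fin.Properties using (toℕ-inject₁; toℕ-fromℕ<; toℕ<n; toℕ-injective)
open import Data.Vec as Vec using (Vec; []; _∷_; lookup; tabulate)
import Data.Vec.Properties as Vecₚ
open import Data.List using (List; []; _∷_; _++_; [_]; reverse; reverseAcc; map; filter; upTo; length)
import Data.List.Properties as Listₚ
open import Data.List.Relation.Unary.All as All using (All; []; _∷_)
import Data.List.Relation.Unary.All.Properties as All
open import Data.List.Relation.Unary.Any using (here; there)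
import Data.List.Relation.Unary.Any.Properties as Any
open import Data.List.Relation.Unary.Linked as Linked using (Linked; []; [-]; _∷_)
import Data.List.Relation.Unary.Linked.Properties as Linked
open import Data.List.Membership.Propositional using (_∈_; _∉_)
open import Data.List.Membership.Propositional.Properties
  using (∈-++⁺ʳ; ∈-map⁺; ∈-map⁻; ∈-filter⁺; ∈-filter⁻; ∈-upTo⁺; ∈-upTo⁻)
open import Data.List.Membership.DecPropositional _≟ℤ_ using (_∈?_)
open import Data.List.Membership.DecPropositional _≟_ using () renaming (_∈?_ to _∈ℕ?_)
open import Data.Maybe as Maybe using (just)
open import Data.Product using (_×_; ∃; _,_; proj₁; proj₂)
open import Data.Empty using (⊥; ⊥-elim)
open import Data.Unit using (⊤; tt)
open import Function using (flip; _∘_; id)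
open import Relation.Nullary using (¬_; Dec; yes; no; ¬?)
open import Relation.Unary using (Decidable)
open import Relation.Binary.PropositionalEquality
  using (_≡_; refl; sym; trans; cong; cong₂; subst; subst₂; module ≡-Reasoning)
open ≡-Reasoning

private
  variable
    A B : Set
    R S : A → A → Set
    m : ℕ

-- Alternating chains x₀ R y₀ R x₁ R y₁ … R xₖ between a list of length k+1
-- and one of length k.  Interleaving of Gelfand–Tsetlin rows and of
-- adjacent staircase columns are both instances.
data Alt {A : Set} (R : A → A → Set) : List A → List A → Set where
  alt-one  : ∀ {x} → Alt R (x ∷ []) []
  alt-cons : ∀ {x x' y xs ys} → R x y → R y x' → Alt R (x' ∷ xs) ys →
             Alt R (x ∷ x' ∷ xs) (y ∷ ys)

alt-reverseAcc : ∀ {x xs ys acc accb} → Alt R (x ∷ xs) ys → Alt (flip R) (x ∷ acc) accb →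
                 Alt (flip R) (reverseAcc (x ∷ acc) xs) (reverseAcc accb ys)
alt-reverseAcc alt-one             done = done
alt-reverseAcc (alt-cons p q rest) done = alt-reverseAcc rest (alt-cons q p done)

alt-reverse : ∀ {xs ys} → Alt R xs ys → Alt (flip R) (reverse xs) (reverse ys)
alt-reverse a@alt-one          = alt-reverseAcc a alt-one
alt-reverse a@(alt-cons _ _ _) = alt-reverseAcc a alt-one

alt-reverse⁻ : ∀ {xs ys} → Alt (flip R) (reverse xs) (reverse ys) → Alt R xs ys
alt-reverse⁻ {xs = xs} {ys} a =
  subst₂ (Alt _) (Listₚ.reverse-involutive xs) (Listₚ.reverse-involutive ys) (alt-reverse a)

alt-map : {f : A → B} → (∀ {x y} → R x y → S (f x) (f y)) →
          ∀ {xs ys} → Alt R xs ys → Alt S (map f xs) (map f ys)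
alt-map g alt-one            = alt-one
alt-map g (alt-cons p q rest) = alt-cons (g p) (g q) (alt-map g rest)

alt-map⁻ : {f : A → B} → (∀ {x y} → S (f x) (f y) → R x y) →
           ∀ {xs ys} → Alt S (map f xs) (map f ys) → Alt R xs ys
alt-map⁻ g {_ ∷ []}     {[]}    alt-one            = alt-one
alt-map⁻ g {_ ∷ _ ∷ _} {_ ∷ _} (alt-cons p q rest) = alt-cons (g p) (g q) (alt-map⁻ g rest)

interleave⇒alt : ∀ {xs ys} → Interleave xs ys → Alt (flip _≤ℤ_) xs ys
interleave⇒alt one          = alt-one
interleave⇒alt (more p q i) = alt-cons p q (interleave⇒alt i)

alt⇒interleave : ∀ {xs ys} → Alt (flip _≤ℤ_) xs ys → Interleave xs ys
alt⇒interleave alt-one            = one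
alt⇒interleave (alt-cons p q rest) = more p q (alt⇒interleave rest)

-- A Gelfand–Tsetlin row is a decreasing list of integers (colsDesc v is Desc (colsUp 1 v));
-- reading it backwards in ℕ turns interleaving into an increasing alternating chain.
Desc : List ℕ → List ℤ
Desc xs = map +_ (reverse xs)

interleave⇒alt≤ : ∀ {xs ys} → Interleave (Desc xs) (Desc ys) → Alt _≤_ xs ys
interleave⇒alt≤ i = alt-reverse⁻ (alt-map⁻ ℤ.drop‿+≤+ (interleave⇒alt i))

alt≤⇒interleave : ∀ {xs ys} → Alt _≤_ xs ys → Interleave (Desc xs) (Desc ys)
alt≤⇒interleave a = alt⇒interleave (alt-map +≤+ (alt-reverse a))

alt-length : ∀ {xs ys} → Alt R xs ys → length xs ≡ suc (length ys)
alt-length alt-one            = refl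
alt-length (alt-cons _ _ rest) = cong suc (alt-length rest)

alt-tail : ∀ {x y xs ys} → Alt R (x ∷ xs) (y ∷ ys) → Alt R xs ys
alt-tail (alt-cons _ _ rest) = rest

alt-extend : ∀ {x y xs ys} → x ≤ y → All (suc y ≤_) xs → Alt _≤_ xs ys → Alt _≤_ (x ∷ xs) (y ∷ ys)
alt-extend x≤y (y<x' ∷ _) rest@alt-one         = alt-cons x≤y (≤-trans (n≤1+n _) y<x') rest
alt-extend x≤y (y<x' ∷ _) rest@(alt-cons _ _ _) = alt-cons x≤y (≤-trans (n≤1+n _) y<x') rest

linked-reverseAcc : ∀ {x xs acc} → Linked R (x ∷ xs) → Linked (flip R) (x ∷ acc) →
                    Linked (flip R) (reverseAcc (x ∷ acc) xs)
linked-reverseAcc [-]        done = done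
linked-reverseAcc (r ∷ rest) done = linked-reverseAcc rest (r ∷ done)

linked-reverse : ∀ {xs} → Linked R xs → Linked (flip R) (reverse xs)
linked-reverse []         = []
linked-reverse l@[-]      = linked-reverseAcc l [-]
linked-reverse l@(_ ∷ _)  = linked-reverseAcc l [-]

linked-spread : {P : A → Set} → (∀ {x y} → R x y → P x → P y) →
                ∀ {x xs} → Linked R (x ∷ xs) → P x → All P (x ∷ xs)
linked-spread stable [-]        px = px ∷ []
linked-spread stable (r ∷ rest) px = px ∷ linked-spread stable rest (stable r px)

module _ (R-trans : ∀ {x y z : A} → R x y → R y z → R x z) (R-irrefl : ∀ {x : A} → ¬ R x x) where

  private
    below : ∀ {x xs y} → Linked R (x ∷ xs) → y ∈ xs → R x y
    below (r ∷ l) = All.lookup (Linked.Linked⇒All R-trans r l)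

    drop-head : ∀ {x xs ys} → Linked R (x ∷ xs) → (∀ {z} → z ∈ x ∷ xs → z ∈ x ∷ ys) →
                ∀ {z} → z ∈ xs → z ∈ ys
    drop-head l sub z∈xs with sub (there z∈xs)
    ... | here refl = ⊥-elim (R-irrefl (below l z∈xs))
    ... | there z∈ys = z∈ys

  sorted-unique : ∀ {xs ys} → Linked R xs → Linked R ys →
                  (∀ {z} → z ∈ xs → z ∈ ys) → (∀ {z} → z ∈ ys → z ∈ xs) → xs ≡ ys
  sorted-unique {[]}     {[]}     _ _ _ _ = refl
  sorted-unique {[]}     {y ∷ _}  _ _ _ sup with () ← sup (here refl)
  sorted-unique {x ∷ _}  {[]}     _ _ sub _ with () ← sub (here refl)
  sorted-unique {x ∷ xs} {y ∷ ys} lx ly sub sup with sub (here refl) | sup (here refl)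
  ... | there x∈ys | there y∈xs = ⊥-elim (R-irrefl (R-trans (below lx y∈xs) (below ly x∈ys)))
  ... | there x∈ys | here refl  = ⊥-elim (R-irrefl (below ly x∈ys))
  ... | here refl  | _          =
    cong (x ∷_) (sorted-unique (Linked.tail lx) (Linked.tail ly) (drop-head lx sub) (drop-head ly sup))

all-reverse : {P : A → Set} {xs : List A} → All P xs → All P (reverse xs)
all-reverse pxs = All.tabulate (All.lookup pxs ∘ Any.reverse⁻)

linked-map-all : {P : A → Set} {S : A → A → Set} → (∀ {x y} → P x → P y → R x y → S x y) →
                 ∀ {xs} → All P xs → Linked R xs → Linked S xs
linked-map-all f _                []         = []
linked-map-all f _                [-]        = [-]
linked-map-all f (px ∷ pxs@(py ∷ _)) (r ∷ rest) = f px py r ∷ linked-map-all f pxs rest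

vec-ext : {v w : Vec A m} → (∀ j → lookup v j ≡ lookup w j) → v ≡ w
vec-ext {v = v} {w} f = trans (sym (Vecₚ.tabulate∘lookup v)) (trans (Vecₚ.tabulate-cong f) (Vecₚ.tabulate∘lookup w))

linked-lookup⁺ : (V : Vec A (suc m)) → (∀ i → R (lookup V (inject₁ i)) (lookup V (fs i))) → Linked R (Vec.toList V)
linked-lookup⁺ (x ∷ [])    _ = [-]
linked-lookup⁺ (x ∷ y ∷ V) f = f fz ∷ linked-lookup⁺ (y ∷ V) (f ∘ fs)

linked-lookup⁻ : (V : Vec A (suc m)) → Linked R (Vec.toList V) → ∀ i → R (lookup V (inject₁ i)) (lookup V (fs i))
linked-lookup⁻ (x ∷ y ∷ V) (r ∷ _)    fz     = r
linked-lookup⁻ (x ∷ y ∷ V) (_ ∷ rest) (fs i) = linked-lookup⁻ (y ∷ V) rest i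

all-tabulate : {P : A → Set} (f : Fin m → A) → (∀ k → P (f k)) → All P (Vec.toList (tabulate f))
all-tabulate {m = zero}  f p = []
all-tabulate {m = suc m} f p = p fz ∷ all-tabulate (f ∘ fs) (p ∘ fs)

toList-init : (V : Vec A (suc m)) → Vec.toList V ≡ Vec.toList (Vec.init V) ++ [ lookup V (fromℕ m) ]
toList-init (x ∷ [])    = refl
toList-init (x ∷ y ∷ V) = cong (x ∷_) (toList-init (y ∷ V))

toList-injective : {V V' : Vec A m} → Vec.toList V ≡ Vec.toList V' → V ≡ V'
toList-injective {V = V} {V'} e = trans (sym (Vecₚ.cast-is-id refl V)) (Vecₚ.toList-injective refl V V' e)

listToVec : (xs : List A) → length xs ≡ m → Vec A m
listToVec []       refl = []
listToVec (x ∷ xs) refl = x ∷ listToVec xs refl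

toList-listToVec : (xs : List A) (e : length xs ≡ m) → Vec.toList (listToVec xs e) ≡ xs
toList-listToVec []       refl = refl
toList-listToVec (x ∷ xs) refl = cong (x ∷_) (toList-listToVec xs refl)

lookup-head : (V : Vec A (suc m)) {x : A} {xs : List A} → Vec.toList V ≡ x ∷ xs → lookup V fz ≡ x
lookup-head (y ∷ V) e = Listₚ.∷-injectiveˡ e

lookup-last : (V : Vec A (suc m)) {x : A} {xs : List A} → Vec.toList V ≡ xs ++ [ x ] → lookup V (fromℕ m) ≡ x
lookup-last V {xs = xs} e = proj₂ (Listₚ.∷ʳ-injective _ xs (trans (sym (toList-init V)) e))

flipS : Spin → Spin
flipS plus  = minus
flipS minus = plus

flipS-involutive : ∀ s → flipS (flipS s) ≡ s
flipS-involutive plus  = refl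
flipS-involutive minus = refl

spin-ext : ∀ {a b : Spin} → (a ≡ minus → b ≡ minus) → (b ≡ minus → a ≡ minus) → a ≡ b
spin-ext {plus}  {plus}  _ _ = refl
spin-ext {plus}  {minus} _ g with () ← g refl
spin-ext {minus} {plus}  f _ with () ← f refl
spin-ext {minus} {minus} _ _ = refl

flipV : Vec Spin m → Vec Spin m
flipV = Vec.map flipS

flipV-involutive : (v : Vec Spin m) → flipV (flipV v) ≡ v
flipV-involutive v = begin
  flipV (flipV v)         ≡⟨ Vecₚ.map-∘ flipS flipS v ⟨
  Vec.map (flipS ∘ flipS) v ≡⟨ Vecₚ.map-cong flipS-involutive v ⟩
  Vec.map id v            ≡⟨ Vecₚ.map-id v ⟩
  v                       ∎

plusCols : Vec Spin m → List ℕ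
plusCols v = colsUp 1 (flipV v)

∈colsUp⁻ : ∀ k (v : Vec Spin m) {x} → x ∈ colsUp k v →
           ∃ λ j → x ≡ k + toℕ j × lookup v j ≡ minus
∈colsUp⁻ k (plus ∷ v) x∈ with ∈colsUp⁻ (suc k) v x∈
... | j , refl , vj = fs j , sym (+-suc k (toℕ j)) , vj
∈colsUp⁻ k (minus ∷ v) (here refl) = fz , sym (+-identityʳ k) , refl
∈colsUp⁻ k (minus ∷ v) (there x∈) with ∈colsUp⁻ (suc k) v x∈
... | j , refl , vj = fs j , sym (+-suc k (toℕ j)) , vj

∈colsUp⁺ : ∀ k (v : Vec Spin m) (j : Fin m) → lookup v j ≡ minus → k + toℕ j ∈ colsUp k v
∈colsUp⁺ k (minus ∷ v) fz     refl = here (+-identityʳ k)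
∈colsUp⁺ k (plus ∷ v)  (fs j) vj   =
  subst (_∈ colsUp (suc k) v) (sym (+-suc k (toℕ j))) (∈colsUp⁺ (suc k) v j vj)
∈colsUp⁺ k (minus ∷ v) (fs j) vj   =
  there (subst (_∈ colsUp (suc k) v) (sym (+-suc k (toℕ j))) (∈colsUp⁺ (suc k) v j vj))

∈colsUp⇒minus : (v : Vec Spin m) (j : Fin m) → suc (toℕ j) ∈ colsUp 1 v → lookup v j ≡ minus
∈colsUp⇒minus v j j∈ with ∈colsUp⁻ 1 v j∈
... | j' , e , vj' with toℕ-injective {i = j} {j = j'} (suc-injective e)
... | refl = vj'

colsUp-sorted : ∀ k (v : Vec Spin m) → Linked _<_ (colsUp k v)
colsUp-sorted k []          = []
colsUp-sorted k (plus ∷ v)  = colsUp-sorted (suc k) v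
colsUp-sorted k (minus ∷ v) with colsUp (suc k) v | ∈colsUp⁻ (suc k) v | colsUp-sorted (suc k) v
... | []    | _      | _ = [-]
... | x ∷ _ | x-form | l with x-form (here refl)
...   | j , refl , _ = s≤s (m≤m+n k (toℕ j)) ∷ l

colsUp-injective : {v w : Vec Spin m} → colsUp 1 v ≡ colsUp 1 w → v ≡ w
colsUp-injective {v = v} {w} e = vec-ext λ j →
  spin-ext (λ vj → ∈colsUp⇒minus w j (subst (_ ∈_) e (∈colsUp⁺ 1 v j vj)))
           (λ wj → ∈colsUp⇒minus v j (subst (_ ∈_) (sym e) (∈colsUp⁺ 1 w j wj)))

∈colsDesc⁻ : (v : Vec Spin m) {z : ℤ} → z ∈ colsDesc v →
             ∃ λ j → z ≡ + suc (toℕ j) × lookup v j ≡ minus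
∈colsDesc⁻ v z∈ with ∈-map⁻ +_ z∈
... | x , x∈ , refl with ∈colsUp⁻ 1 v (Any.reverse⁻ x∈)
... | j , refl , vj = j , refl , vj

∈colsDesc⁺ : (v : Vec Spin m) (j : Fin m) → lookup v j ≡ minus → + suc (toℕ j) ∈ colsDesc v
∈colsDesc⁺ v j vj = ∈-map⁺ +_ (Any.reverse⁺ (∈colsUp⁺ 1 v j vj))

∈colsDesc⇒minus : (v : Vec Spin m) (j : Fin m) → + suc (toℕ j) ∈ colsDesc v → lookup v j ≡ minus
∈colsDesc⇒minus v j j∈ with ∈-map⁻ +_ j∈
... | x , x∈ , refl = ∈colsUp⇒minus v j (Any.reverse⁻ x∈)

colsDesc-sorted : (v : Vec Spin m) → Linked _>ℤ_ (colsDesc v)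
colsDesc-sorted v = Linked.map⁺ (Linked.map +<+ (linked-reverse (colsUp-sorted 1 v)))

InRange : ℕ → ℕ → Set
InRange N x = 1 ≤ x × x ≤ N

InRangeℤ : ℕ → ℤ → Set
InRangeℤ N z = + 1 ≤ℤ z × z ≤ℤ + N

Column : ℕ → List ℕ → Set
Column N c = Linked _<_ c × All (InRange N) c

StrictRow : ℕ → List ℤ → Set
StrictRow N r = Linked _>ℤ_ r × All (InRangeℤ N) r

position : ∀ {N x} → InRange N x → ∃ λ (j : Fin N) → x ≡ suc (toℕ j)
position {x = suc x} (_ , x<N) = fromℕ< x<N , cong suc (sym (toℕ-fromℕ< x<N))

positionℤ : ∀ {N z} → InRangeℤ N z → ∃ λ (j : Fin N) → z ≡ + suc (toℕ j)
positionℤ {z = + x} (+≤+ 1≤x , +≤+ x≤N) with position (1≤x , x≤N)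
... | j , refl = j , refl

spinOf : {Q : Set} → Dec Q → Spin
spinOf (yes _) = minus
spinOf (no _)  = plus

indicator : {P : ℕ → Set} → Decidable P → (N : ℕ) → Vec Spin N
indicator P? N = tabulate (λ j → spinOf (P? (suc (toℕ j))))

module _ {P : ℕ → Set} (P? : Decidable P) {N : ℕ} (j : Fin N) where

  indicator-minus⁻ : lookup (indicator P? N) j ≡ minus → P (suc (toℕ j))
  indicator-minus⁻ e rewrite Vecₚ.lookup∘tabulate (λ j → spinOf (P? (suc (toℕ j)))) j
    with P? (suc (toℕ j))
  ... | yes p = p
  ... | no _  with () ← e

  indicator-minus⁺ : P (suc (toℕ j)) → lookup (indicator P? N) j ≡ minus
  indicator-minus⁺ p rewrite Vecₚ.lookup∘tabulate (λ j → spinOf (P? (suc (toℕ j)))) j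
    with P? (suc (toℕ j))
  ... | yes _ = refl
  ... | no ¬p = ⊥-elim (¬p p)

>ℤ-trans : ∀ {x y z : ℤ} → x >ℤ y → y >ℤ z → x >ℤ z
>ℤ-trans x>y y>z = ℤ.<-trans y>z x>y

>ℤ-irrefl : ∀ {x : ℤ} → ¬ x >ℤ x
>ℤ-irrefl = ℤ.<-irrefl refl

colsUp-column : (v : Vec Spin m) → Column m (colsUp 1 v)
colsUp-column v = colsUp-sorted 1 v , All.tabulate in-range
  where
  in-range : ∀ {x} → x ∈ colsUp 1 v → InRange _ x
  in-range x∈ with ∈colsUp⁻ 1 v x∈
  ... | j , refl , _ = s≤s z≤n , toℕ<n j

_∈?ᵣ_ : (x : ℕ) (r : List ℤ) → Dec (+ x ∈ r)
x ∈?ᵣ r = + x ∈? r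

minusVec : (N : ℕ) → List ℤ → Vec Spin N
minusVec N r = indicator (_∈?ᵣ r) N

plusVec : (N : ℕ) → List ℕ → Vec Spin N
plusVec N c = flipV (indicator (_∈ℕ? c) N)

colsDesc-minusVec : ∀ {N r} → StrictRow N r → colsDesc (minusVec N r) ≡ r
colsDesc-minusVec {N} {r} (sorted , range) =
  sorted-unique >ℤ-trans >ℤ-irrefl (colsDesc-sorted (minusVec N r)) sorted sub sup
  where
  sub : ∀ {z} → z ∈ colsDesc (minusVec N r) → z ∈ r
  sub z∈ with ∈colsDesc⁻ (minusVec N r) z∈
  ... | j , refl , vj = indicator-minus⁻ (_∈?ᵣ r) j vj
  sup : ∀ {z} → z ∈ r → z ∈ colsDesc (minusVec N r)
  sup z∈ with positionℤ (All.lookup range z∈)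
  ... | j , refl = ∈colsDesc⁺ (minusVec N r) j (indicator-minus⁺ (_∈?ᵣ r) j z∈)

plusCols-plusVec : ∀ {N c} → Column N c → plusCols (plusVec N c) ≡ c
plusCols-plusVec {N} {c} (sorted , range) = begin
  colsUp 1 (flipV (flipV v)) ≡⟨ cong (colsUp 1) (flipV-involutive v) ⟩
  colsUp 1 v                 ≡⟨ sorted-unique <-trans (<-irrefl refl) (colsUp-sorted 1 v) sorted sub sup ⟩
  c                          ∎
  where
  v = indicator (_∈ℕ? c) N
  sub : ∀ {x} → x ∈ colsUp 1 v → x ∈ c
  sub x∈ with ∈colsUp⁻ 1 v x∈
  ... | j , refl , vj = indicator-minus⁻ (_∈ℕ? c) j vj
  sup : ∀ {x} → x ∈ c → x ∈ colsUp 1 v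
  sup x∈ with position (All.lookup range x∈)
  ... | j , refl = ∈colsUp⁺ 1 v j (indicator-minus⁺ (_∈ℕ? c) j x∈)

plusVec-plusCols : (v : Vec Spin m) → plusVec m (plusCols v) ≡ v
plusVec-plusCols v = begin
  plusVec _ (plusCols v)                ≡⟨ flipV-involutive _ ⟨
  flipV (flipV (plusVec _ (plusCols v))) ≡⟨ cong flipV (colsUp-injective (plusCols-plusVec (colsUp-column (flipV v)))) ⟩
  flipV (flipV v)                       ≡⟨ flipV-involutive v ⟩
  v                                     ∎

cols-count : ∀ k (v : Vec Spin m) → length (colsUp k v) + length (colsUp k (flipV v)) ≡ m
cols-count k []          = refl
cols-count k (plus ∷ v)  = trans (+-suc _ _) (cong suc (cols-count (suc k) v))
cols-count k (minus ∷ v) = cong suc (cols-count (suc k) v)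

module _ {N : ℕ} {r : List ℤ} where

  private
    notIn? : Decidable (λ x → + x ∉ r)
    notIn? x = ¬? (+ x ∈? r)

  ∈compl⁻ : ∀ {x} → x ∈ compl N r → InRange N x × + x ∉ r
  ∈compl⁻ x∈ with ∈-filter⁻ notIn? {xs = map suc (upTo N)} x∈
  ... | x∈range , x∉r with ∈-map⁻ suc x∈range
  ... | i , i∈ , refl = (s≤s z≤n , ∈-upTo⁻ i∈) , x∉r

  ∈compl⁺ : ∀ {x} → InRange N x → + x ∉ r → x ∈ compl N r
  ∈compl⁺ {suc i} (_ , i<N) x∉r = ∈-filter⁺ notIn? (∈-map⁺ suc (∈-upTo⁺ i<N)) x∉r

  compl-sorted : Linked _<_ (compl N r)
  compl-sorted = Linked.filter⁺ notIn? <-trans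
    (subst (Linked _<_) (sym (Listₚ.map-upTo suc N)) (Linked.applyUpTo⁺₂ suc N (λ _ → ≤-refl)))

compl-colsDesc : (v : Vec Spin m) → compl m (colsDesc v) ≡ plusCols v
compl-colsDesc {m} v = sorted-unique <-trans (<-irrefl refl) (compl-sorted {m} {colsDesc v}) (colsUp-sorted 1 (flipV v)) sub sup
  where
  sub : ∀ {x} → x ∈ compl m (colsDesc v) → x ∈ plusCols v
  sub x∈ = let (range , x∉) = ∈compl⁻ x∈ in at (position range) x∉
    where
    at : ∀ {x} → (∃ λ (j : Fin m) → x ≡ suc (toℕ j)) → + x ∉ colsDesc v → x ∈ plusCols v
    at (j , refl) x∉ with lookup v j in vj
    ... | plus  = ∈colsUp⁺ 1 (flipV v) j (trans (Vecₚ.lookup-map j flipS v) (cong flipS vj))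
    ... | minus = ⊥-elim (x∉ (∈colsDesc⁺ v j vj))
  sup : ∀ {x} → x ∈ plusCols v → x ∈ compl m (colsDesc v)
  sup x∈ with ∈colsUp⁻ 1 (flipV v) x∈
  ... | j , refl , fj = ∈compl⁺ (s≤s z≤n , toℕ<n j) (λ j∈ → clash (∈colsDesc⇒minus v j j∈))
    where
    clash : lookup v j ≡ minus → ⊥
    clash vj with () ← trans (sym fj) (trans (Vecₚ.lookup-map j flipS v) (cong flipS vj))

coCol : ℕ → List ℕ → List ℤ
coCol N c = colsDesc (plusVec N c)

module _ {N : ℕ} where

  compl-strictRow : ∀ {r} → StrictRow N r → compl N r ≡ plusCols (minusVec N r)
  compl-strictRow {r} row = trans (cong (compl N) (sym (colsDesc-minusVec row))) (compl-colsDesc (minusVec N r))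

  compl-coCol : ∀ {c} → Column N c → compl N (coCol N c) ≡ c
  compl-coCol {c} col = trans (compl-colsDesc (plusVec N c)) (plusCols-plusVec col)

  coCol-compl : ∀ {r} → StrictRow N r → coCol N (compl N r) ≡ r
  coCol-compl {r} row = begin
    colsDesc (plusVec N (compl N r))                ≡⟨ cong (colsDesc ∘ plusVec N) (compl-strictRow row) ⟩
    colsDesc (plusVec N (plusCols (minusVec N r)))  ≡⟨ cong colsDesc (plusVec-plusCols (minusVec N r)) ⟩
    colsDesc (minusVec N r)                         ≡⟨ colsDesc-minusVec row ⟩
    r                                               ∎

  compl-column : ∀ {r} → Column N (compl N r)
  compl-column {r} = compl-sorted {N} {r} , All.tabulate (proj₁ ∘ ∈compl⁻)

  compl-[]-length : length (compl N []) ≡ N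
  compl-[]-length = begin
    length (filter notIn[]? (map suc (upTo N)))
      ≡⟨ cong length (Listₚ.filter-all notIn[]? {xs = map suc (upTo N)} (All.universal (λ _ ()) _)) ⟩
    length (map suc (upTo N)) ≡⟨ Listₚ.length-map suc (upTo N) ⟩
    length (upTo N)           ≡⟨ Listₚ.length-upTo N ⟩
    N                         ∎
    where
    notIn[]? : Decidable (λ x → + x ∉ [])
    notIn[]? x = ¬? (+ x ∈? [])

  coCol-full : ∀ {c} → Column N c → length c ≡ N → coCol N c ≡ []
  coCol-full {c} col full with colsUp 1 (plusVec N c) | cols-count 1 (plusVec N c)
  ... | []    | _     = refl
  ... | x ∷ xs | count with () ← +-cancelʳ-≡ N (suc (length xs)) 0 (begin
    suc (length xs) + N
      ≡⟨ cong (λ k → suc (length xs) + k) (trans (sym full) (cong length (sym (plusCols-plusVec col)))) ⟩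
    suc (length xs) + length (plusCols (plusVec N c)) ≡⟨ count ⟩
    N                                              ∎)

-- One row of the lattice.  hv lists the horizontal spins of the row from right to
-- left (hv[0] is the right boundary edge), t and b the vertical spins above and
-- below its vertices; Row hv t b says that every vertex of the row is admissible.
Row : Vec Spin (suc m) → Vec Spin m → Vec Spin m → Set
Row {zero}  _        []      []      = ⊤
Row {suc m} (r ∷ hs) (x ∷ t) (y ∷ b) = Allowed (Vec.head hs) x r y × Row hs t b

Boundary : Vec Spin (suc m) → Set
Boundary {m} hv = lookup hv fz ≡ minus × lookup hv (fromℕ m) ≡ plus

pointwise⇒row : (hv : Vec Spin (suc m)) (t b : Vec Spin m) →
  (∀ j → Allowed (lookup hv (fs j)) (lookup t j) (lookup hv (inject₁ j)) (lookup b j)) → Row hv t b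
pointwise⇒row {zero}  _            []      []      _ = tt
pointwise⇒row {suc m} (r ∷ l ∷ hs) (x ∷ t) (y ∷ b) f = f fz , pointwise⇒row (l ∷ hs) t b (f ∘ fs)

row⇒pointwise : (hv : Vec Spin (suc m)) (t b : Vec Spin m) → Row hv t b →
  ∀ j → Allowed (lookup hv (fs j)) (lookup t j) (lookup hv (inject₁ j)) (lookup b j)
row⇒pointwise (r ∷ l ∷ hs) (x ∷ t) (y ∷ b) (a , _)    fz     = a
row⇒pointwise (r ∷ l ∷ hs) (x ∷ t) (y ∷ b) (_ , rest) (fs j) = row⇒pointwise (l ∷ hs) t b rest j

-- At an admissible vertex the left spin is determined by the right, top and bottom ones
-- (the number of − spins entering equals the number leaving).
leftSpin : Spin → Spin → Spin → Spin
leftSpin r plus  plus  = r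
leftSpin r minus minus = r
leftSpin r minus plus  = plus
leftSpin r plus  minus = minus

allowed⇒leftSpin : ∀ {l x r y} → Allowed l x r y → l ≡ leftSpin r x y
allowed⇒leftSpin a1 = refl
allowed⇒leftSpin a2 = refl
allowed⇒leftSpin b1 = refl
allowed⇒leftSpin b2 = refl
allowed⇒leftSpin c1 = refl
allowed⇒leftSpin c2 = refl

leftSpins : Spin → Vec Spin m → Vec Spin m → Vec Spin m
leftSpins r []      []      = []
leftSpins r (x ∷ t) (y ∷ b) = leftSpin r x y ∷ leftSpins (leftSpin r x y) t b

row-forced : ∀ r (hs : Vec Spin m) t b → Row (r ∷ hs) t b → hs ≡ leftSpins r t b
row-forced r []       []      []      _          = refl
row-forced r (l ∷ hs) (x ∷ t) (y ∷ b) (a , rest) with refl ← allowed⇒leftSpin a =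
  cong (leftSpin r x y ∷_) (row-forced (leftSpin r x y) hs t b rest)

colsUp-lower : ∀ k (v : Vec Spin m) → All (k ≤_) (colsUp k v)
colsUp-lower k v = All.tabulate λ x∈ → lower (∈colsUp⁻ k v x∈)
  where
  lower : ∀ {x} → (∃ λ (j : Fin _) → x ≡ k + toℕ j × lookup v j ≡ minus) → k ≤ x
  lower (j , refl , _) = m≤m+n k (toℕ j)

-- Scan a row from right to left, starting at column k.  While the
-- horizontal spin on the right of the current vertex is −, the − columns still to come
-- above the row outnumber those below it by one; while it is +, a − column K above the
-- row is waiting to be matched by a − column below it at some column ≥ K.
mutual
  row₋⇒alt : ∀ k (hs : Vec Spin m) t b → Row (minus ∷ hs) t b → lookup (minus ∷ hs) (fromℕ m) ≡ plus →
             Alt _≤_ (colsUp k t) (colsUp k b)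
  row₋⇒alt k []       []          []          _         ()
  row₋⇒alt k (_ ∷ hs) (plus ∷ t)  (plus ∷ b)  (b2 , row) left = row₋⇒alt (suc k) hs t b row left
  row₋⇒alt k (_ ∷ hs) (minus ∷ t) (plus ∷ b)  (c2 , row) left = row₊⇒alt k (suc k) (n≤1+n k) hs t b row left
  row₋⇒alt k (_ ∷ hs) (minus ∷ t) (minus ∷ b) (a2 , row) left =
    alt-extend ≤-refl (colsUp-lower (suc k) t) (row₋⇒alt (suc k) hs t b row left)

  row₊⇒alt : ∀ K k → K ≤ k → (hs : Vec Spin m) → ∀ t b → Row (plus ∷ hs) t b →
             lookup (plus ∷ hs) (fromℕ m) ≡ plus → Alt _≤_ (K ∷ colsUp k t) (colsUp k b)
  row₊⇒alt K k K≤k []       []          []          _          _    = alt-one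
  row₊⇒alt K k K≤k (_ ∷ hs) (plus ∷ t)  (plus ∷ b)  (a1 , row) left =
    row₊⇒alt K (suc k) (≤-trans K≤k (n≤1+n k)) hs t b row left
  row₊⇒alt K k K≤k (_ ∷ hs) (plus ∷ t)  (minus ∷ b) (c1 , row) left =
    alt-extend K≤k (colsUp-lower (suc k) t) (row₋⇒alt (suc k) hs t b row left)
  row₊⇒alt K k K≤k (_ ∷ hs) (minus ∷ t) (minus ∷ b) (b1 , row) left =
    alt-cons K≤k ≤-refl (row₊⇒alt k (suc k) (n≤1+n k) hs t b row left)

no-first-below : ∀ {k xs ys} → All (suc k ≤_) xs → ¬ Alt _≤_ xs (k ∷ ys)
no-first-below (k<x ∷ _) (alt-cons x≤k _ _) = <-irrefl refl (≤-trans k<x x≤k)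

no-second-below : ∀ {K k xs ys} → All (suc k ≤_) ys → ¬ Alt _≤_ (K ∷ k ∷ xs) ys
no-second-below (k<y ∷ _) (alt-cons _ y≤k _) = <-irrefl refl (≤-trans k<y y≤k)

mutual
  alt⇒row₋ : ∀ k (t b : Vec Spin m) → Alt _≤_ (colsUp k t) (colsUp k b) →
             Row (minus ∷ leftSpins minus t b) t b × lookup (minus ∷ leftSpins minus t b) (fromℕ m) ≡ plus
  alt⇒row₋ k []          []          ()
  alt⇒row₋ k (plus ∷ t)  (plus ∷ b)  alt = let row , left = alt⇒row₋ (suc k) t b alt in (b2 , row) , left
  alt⇒row₋ k (plus ∷ t)  (minus ∷ b) alt = ⊥-elim (no-first-below (colsUp-lower (suc k) t) alt)
  alt⇒row₋ k (minus ∷ t) (plus ∷ b)  alt = let row , left = alt⇒row₊ k (suc k) t b alt in (c2 , row) , left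
  alt⇒row₋ k (minus ∷ t) (minus ∷ b) alt =
    let row , left = alt⇒row₋ (suc k) t b (alt-tail alt) in (a2 , row) , left

  alt⇒row₊ : ∀ K k (t b : Vec Spin m) → Alt _≤_ (K ∷ colsUp k t) (colsUp k b) →
             Row (plus ∷ leftSpins plus t b) t b × lookup (plus ∷ leftSpins plus t b) (fromℕ m) ≡ plus
  alt⇒row₊ K k []          []          _   = tt , refl
  alt⇒row₊ K k (plus ∷ t)  (plus ∷ b)  alt = let row , left = alt⇒row₊ K (suc k) t b alt in (a1 , row) , left
  alt⇒row₊ K k (plus ∷ t)  (minus ∷ b) alt =
    let row , left = alt⇒row₋ (suc k) t b (alt-tail alt) in (c1 , row) , left
  alt⇒row₊ K k (minus ∷ t) (plus ∷ b)  alt = ⊥-elim (no-second-below (colsUp-lower (suc k) b) alt)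
  alt⇒row₊ K k (minus ∷ t) (minus ∷ b) alt =
    let row , left = alt⇒row₊ k (suc k) t b (alt-tail alt) in (b1 , row) , left

forcedRow : Vec Spin m → Vec Spin m → Vec Spin (suc m)
forcedRow t b = minus ∷ leftSpins minus t b

row⇒interleave : (hv : Vec Spin (suc m)) (t b : Vec Spin m) → Row hv t b → Boundary hv →
                 Interleave (colsDesc t) (colsDesc b)
row⇒interleave (.minus ∷ hs) t b row (refl , left) = alt≤⇒interleave (row₋⇒alt 1 hs t b row left)

row≡forcedRow : (hv : Vec Spin (suc m)) (t b : Vec Spin m) → Row hv t b → Boundary hv → hv ≡ forcedRow t b
row≡forcedRow (.minus ∷ hs) t b row (refl , _) = cong (minus ∷_) (row-forced minus hs t b row)

interleave⇒row : (t b : Vec Spin m) → Interleave (colsDesc t) (colsDesc b) →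
                 Row (forcedRow t b) t b × Boundary (forcedRow t b)
interleave⇒row t b i = let row , left = alt⇒row₋ 1 t b (interleave⇒alt≤ i) in row , refl , left

allowed-flip : ∀ {l x r y} → Allowed l x r y → Allowed l (flipS y) r (flipS x)
allowed-flip a1 = b1
allowed-flip a2 = b2
allowed-flip b1 = a1
allowed-flip b2 = a2
allowed-flip c1 = c1
allowed-flip c2 = c2

row-flip : (hv : Vec Spin (suc m)) (t b : Vec Spin m) → Row hv t b → Row hv (flipV b) (flipV t)
row-flip {zero}  _        []      []      _          = tt
row-flip {suc m} (r ∷ hs) (x ∷ t) (y ∷ b) (a , rest) = allowed-flip a , row-flip hs t b rest

-- Complement duality: the − columns of t and b interleave iff the + columns of b and t
-- alternate (for the flipped row is admissible as well).
interleave⇒plusCols : (t b : Vec Spin m) → Interleave (colsDesc t) (colsDesc b) →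
                      Alt _≤_ (plusCols b) (plusCols t)
interleave⇒plusCols t b i =
  let row , _ , left = interleave⇒row t b i
  in row₋⇒alt 1 (leftSpins minus t b) (flipV b) (flipV t) (row-flip (forcedRow t b) t b row) left

plusCols⇒interleave : (t b : Vec Spin m) → Alt _≤_ (plusCols b) (plusCols t) →
                      Interleave (colsDesc t) (colsDesc b)
plusCols⇒interleave t b alt =
  let row , left = alt⇒row₋ 1 (flipV b) (flipV t) alt
      hv = forcedRow (flipV b) (flipV t)
  in row⇒interleave hv t b
       (subst₂ (Row hv) (flipV-involutive t) (flipV-involutive b) (row-flip hv (flipV b) (flipV t) row))
       (refl , left)

module _ {N : ℕ} where

  compl-interleave : ∀ {r r'} → StrictRow N r → StrictRow N r' → Interleave r r' →
                     Alt _≤_ (compl N r') (compl N r)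
  compl-interleave {r} {r'} row row' i =
    subst₂ (Alt _≤_) (sym (compl-strictRow row')) (sym (compl-strictRow row))
      (interleave⇒plusCols (minusVec N r) (minusVec N r')
        (subst₂ Interleave (sym (colsDesc-minusVec row)) (sym (colsDesc-minusVec row')) i))

  coCol-interleave : ∀ {c c'} → Column N c → Column N c' → Alt _≤_ c c' →
                     Interleave (coCol N c') (coCol N c)
  coCol-interleave {c} {c'} col col' alt =
    plusCols⇒interleave (plusVec N c') (plusVec N c)
      (subst₂ (Alt _≤_) (sym (plusCols-plusVec col)) (sym (plusCols-plusVec col')) alt)

lamRhoEntry : ∀ {n} → Vec ℕ n → Fin n → ℕ
lamRhoEntry {n} lam k = lookup lam k + (n ∸ toℕ k)

-- Consecutive entries strictly decrease (λ is weakly decreasing, n − k strictly), and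
-- every entry lies in [1, n + λ₁].
lamRhoEntry-step : ∀ {n} (lam : Vec ℕ (suc n)) → IsPartition lam → (i : Fin n) →
                   lamRhoEntry lam (fs i) < lamRhoEntry lam (inject₁ i)
lamRhoEntry-step {n} lam part i =
  +-mono-≤-< (part (inject₁ i) (fs i) (≤-trans (≤-reflexive (toℕ-inject₁ i)) (n≤1+n _)))
             (subst (λ k → suc n ∸ suc (toℕ i) < suc n ∸ k) (sym (toℕ-inject₁ i))
                    (∸-monoʳ-< ≤-refl (s≤s (<⇒≤ (toℕ<n i)))))

lamRhoEntry-range : ∀ {n} (lam : Vec ℕ n) → IsPartition lam →
                    ∀ k → InRange (n + first lam) (lamRhoEntry lam k)
lamRhoEntry-range {suc n} lam@(l₀ ∷ _) part k =
  ≤-trans (m<n⇒0<n∸m (toℕ<n k)) (m≤n+m _ _) ,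
  subst (lamRhoEntry lam k ≤_) (+-comm l₀ (suc n)) (+-mono-≤ (part fz k z≤n) (m∸n≤m (suc n) (toℕ k)))

lamRho-decreasing : ∀ {n} (lam : Vec ℕ n) → IsPartition lam → Linked (flip _<_) (lamRho lam)
lamRho-decreasing {zero}  []  _    = []
lamRho-decreasing {suc n} lam part = linked-lookup⁺ (tabulate (lamRhoEntry lam)) λ i →
  subst₂ (flip _<_) (sym (Vecₚ.lookup∘tabulate (lamRhoEntry lam) (inject₁ i)))
                    (sym (Vecₚ.lookup∘tabulate (lamRhoEntry lam) (fs i)))
         (lamRhoEntry-step lam part i)

lamRho-range : ∀ {n} (lam : Vec ℕ n) → IsPartition lam → All (InRange (n + first lam)) (lamRho lam)
lamRho-range lam part = all-tabulate (lamRhoEntry lam) (lamRhoEntry-range lam part)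

lamRhoℤ-strictRow : ∀ {n} (lam : Vec ℕ n) → IsPartition lam → StrictRow (n + first lam) (lamRhoℤ lam)
lamRhoℤ-strictRow lam part =
  Linked.map⁺ (Linked.map +<+ (lamRho-decreasing lam part)) ,
  All.map⁺ (All.map (λ (lo , hi) → +≤+ lo , +≤+ hi) (lamRho-range lam part))

lamRhoℤ-length : ∀ {n} (lam : Vec ℕ n) → length (lamRhoℤ lam) ≡ n
lamRhoℤ-length lam = trans (Listₚ.length-map +_ (lamRho lam)) (Vecₚ.length-toList (tabulate (lamRhoEntry lam)))

∈lamRhoℤ⁻ : ∀ {n x} (lam : Vec ℕ n) → + x ∈ lamRhoℤ lam → x ∈ lamRho lam
∈lamRhoℤ⁻ lam x∈ with ∈-map⁻ +_ x∈
... | _ , y∈ , refl = y∈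

gtRows⇒chain : ∀ {p} → GTRows p → Linked Interleave (p ++ [ [] ])
gtRows⇒chain lastRow    = one ∷ [-]
gtRows⇒chain (step i g) = i ∷ gtRows⇒chain g

chain⇒gtRows : ∀ r p → Linked Interleave (r ∷ p ++ [ [] ]) → GTRows (r ∷ p)
chain⇒gtRows r []       (one ∷ [-])  = lastRow
chain⇒gtRows r (r' ∷ p) (i ∷ rest)   = step i (chain⇒gtRows r' p rest)

chain-length : ∀ r p → Linked Interleave (r ∷ p ++ [ [] ]) → length (r ∷ p) ≡ length r
chain-length r []       (i ∷ [-])  = sym (alt-length (interleave⇒alt i))
chain-length r (r' ∷ p) (i ∷ rest) = trans (cong suc (chain-length r' p rest)) (sym (alt-length (interleave⇒alt i)))

interleave-range : ∀ {N r r'} → Interleave r r' → All (InRangeℤ N) r → All (InRangeℤ N) r'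
interleave-range one                 _ = []
interleave-range (more b≤a a'≤b i) ((_ , a≤N) ∷ rest@((1≤a' , _) ∷ _)) =
  (ℤ.≤-trans 1≤a' a'≤b , ℤ.≤-trans b≤a a≤N) ∷ interleave-range i rest

pattern-rows : ∀ {N top p} → StrictRow N top → IsStrictGTTop top p → All (StrictRow N) (p ++ [ [] ])
pattern-rows (_ , top-range) (gt , strict , rest , refl) =
  All.zip (All.++⁺ strict ([] ∷ []) , linked-spread interleave-range (gtRows⇒chain gt) top-range)

pattern-length : ∀ {top p} → IsStrictGTTop top p → length p ≡ length top
pattern-length (gt , _ , rest , refl) = chain-length _ rest (gtRows⇒chain gt)

colsDesc-injective : {v w : Vec Spin m} → colsDesc v ≡ colsDesc w → v ≡ w
colsDesc-injective = colsUp-injective ∘ Listₚ.reverse-injective ∘ Listₚ.map-injective ℤ.+-injective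

colsDesc≡[]⇒plus : (v : Vec Spin m) → colsDesc v ≡ [] → ∀ j → lookup v j ≡ plus
colsDesc≡[]⇒plus v e j with lookup v j in vj
... | plus  = refl
... | minus with () ← subst (_ ∈_) e (∈colsDesc⁺ v j vj)

plus⇒colsDesc≡[] : (v : Vec Spin m) → (∀ j → lookup v j ≡ plus) → colsDesc v ≡ []
plus⇒colsDesc≡[] v allPlus with colsUp 1 v | ∈colsUp⁻ 1 v
... | []    | _      = refl
... | x ∷ _ | x-form with x-form (here refl)
...   | j , _ , vj with () ← trans (sym (allPlus j)) vj

rowSets : ∀ {k N} → Vec (Vec Spin N) k → List (List ℤ)
rowSets W = map colsDesc (Vec.toList W)

module _ {k N : ℕ} (W : Vec (Vec Spin N) (suc k)) where

  private
    rowSets≡ : rowSets W ≡ Vec.toList (Vec.map colsDesc W)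
    rowSets≡ = sym (Vecₚ.toList-map colsDesc W)

  rowSets-linked⁺ : (∀ i → Interleave (colsDesc (lookup W (inject₁ i))) (colsDesc (lookup W (fs i)))) →
                    Linked Interleave (rowSets W)
  rowSets-linked⁺ f = subst (Linked Interleave) (sym rowSets≡) (linked-lookup⁺ (Vec.map colsDesc W) λ i →
    subst₂ Interleave (sym (Vecₚ.lookup-map (inject₁ i) colsDesc W)) (sym (Vecₚ.lookup-map (fs i) colsDesc W)) (f i))

  rowSets-linked⁻ : Linked Interleave (rowSets W) →
                    ∀ i → Interleave (colsDesc (lookup W (inject₁ i))) (colsDesc (lookup W (fs i)))
  rowSets-linked⁻ chain i =
    subst₂ Interleave (Vecₚ.lookup-map (inject₁ i) colsDesc W) (Vecₚ.lookup-map (fs i) colsDesc W)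
      (linked-lookup⁻ (Vec.map colsDesc W) (subst (Linked Interleave) rowSets≡ chain) i)

  rowSets-head : ∀ {x xs} → rowSets W ≡ x ∷ xs → colsDesc (lookup W fz) ≡ x
  rowSets-head e = trans (sym (Vecₚ.lookup-map fz colsDesc W)) (lookup-head (Vec.map colsDesc W) (trans (sym rowSets≡) e))

  rowSets-last : ∀ {x} xs → rowSets W ≡ xs ++ [ x ] → colsDesc (lookup W (fromℕ k)) ≡ x
  rowSets-last xs e =
    trans (sym (Vecₚ.lookup-map (fromℕ k) colsDesc W))
          (lookup-last (Vec.map colsDesc W) {xs = xs} (trans (sym rowSets≡) e))

  rowSets-split : (∀ j → lookup (lookup W (fromℕ k)) j ≡ plus) →
                  rowSets W ≡ Vec.toList (Vec.map colsDesc (Vec.init W)) ++ [ [] ]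
  rowSets-split bottom = begin
    map colsDesc (Vec.toList W)                                      ≡⟨ cong (map colsDesc) (toList-init W) ⟩
    map colsDesc (Vec.toList (Vec.init W) ++ [ lookup W (fromℕ k) ])
      ≡⟨ Listₚ.map-++ colsDesc (Vec.toList (Vec.init W)) _ ⟩
    rowSets (Vec.init W) ++ [ colsDesc (lookup W (fromℕ k)) ]
      ≡⟨ cong₂ (λ xs x → xs ++ [ x ]) (sym (Vecₚ.toList-map colsDesc (Vec.init W)))
                                       (plus⇒colsDesc≡[] (lookup W (fromℕ k)) bottom) ⟩
    Vec.toList (Vec.map colsDesc (Vec.init W)) ++ [ [] ]             ∎

forcedHor : ∀ {n N} → Vec (Vec Spin N) (suc n) → Vec (Vec Spin (suc N)) n
forcedHor W = tabulate (λ i → forcedRow (lookup W (inject₁ i)) (lookup W (fs i)))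

module StatesToPatterns {n : ℕ} (lam : Vec ℕ n) (part : IsPartition lam) where

  N : ℕ
  N = n + first lam

  TopLamRho : Vec Spin N → Set
  TopLamRho w = ∀ j → (lookup w j ≡ minus → suc (toℕ j) ∈ lamRho lam)
                    × (suc (toℕ j) ∈ lamRho lam → lookup w j ≡ minus)

  top⇒lamRho : (w : Vec Spin N) → TopLamRho w → colsDesc w ≡ lamRhoℤ lam
  top⇒lamRho w top = trans (cong colsDesc w≡) (colsDesc-minusVec (lamRhoℤ-strictRow lam part))
    where
    w≡ : w ≡ minusVec N (lamRhoℤ lam)
    w≡ = vec-ext λ j → spin-ext
      (λ wj → indicator-minus⁺ (_∈?ᵣ lamRhoℤ lam) j (∈-map⁺ +_ (proj₁ (top j) wj)))
      (λ mj → proj₂ (top j) (∈lamRhoℤ⁻ lam (indicator-minus⁻ (_∈?ᵣ lamRhoℤ lam) j mj)))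

  lamRho⇒top : (w : Vec Spin N) → colsDesc w ≡ lamRhoℤ lam → TopLamRho w
  lamRho⇒top w e j =
    (λ wj → ∈lamRhoℤ⁻ lam (subst (_ ∈_) e (∈colsDesc⁺ w j wj))) ,
    (λ j∈ → ∈colsDesc⇒minus w j (subst (_ ∈_) (sym e) (∈-map⁺ +_ j∈)))

  module _ {s : State n N} (adm : Admissible lam s) where
    open Admissible adm

    row-boundary : ∀ i → Row (lookup (hor s) i) (lookup (ver s) (inject₁ i)) (lookup (ver s) (fs i))
                       × Boundary (lookup (hor s) i)
    row-boundary i = pointwise⇒row _ _ _ (vertices i) , rightBdry i , leftBdry i

    rowSets-state : rowSets (ver s) ≡ gtOfState s ++ [ [] ]
    rowSets-state = rowSets-split (ver s) bottomBdry

    gtChain : Linked Interleave (gtOfState s ++ [ [] ])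
    gtChain = subst (Linked Interleave) rowSets-state
      (rowSets-linked⁺ (ver s) λ i → let row , bd = row-boundary i in row⇒interleave _ _ _ row bd)

    hor-forced : hor s ≡ forcedHor (ver s)
    hor-forced = vec-ext λ i → trans (let row , bd = row-boundary i in row≡forcedRow _ _ _ row bd)
                                     (sym (Vecₚ.lookup∘tabulate _ i))

  gtOfState-top : 1 ≤ n → (s : State n N) → ∃ λ rest → gtOfState s ≡ colsDesc (lookup (ver s) fz) ∷ rest
  gtOfState-top (s≤s z≤n) (mkState _ (w ∷ w' ∷ W)) = _ , refl

  states→patterns : 1 ≤ n → ∀ s → Admissible lam s → IsStrictGTTop (lamRhoℤ lam) (gtOfState s)
  states→patterns 1≤n s adm with gtOfState-top 1≤n s
  ... | rest , e = gt , strict , rest , trans e (cong (_∷ rest) (top⇒lamRho (lookup (ver s) fz) (Admissible.topBdry adm)))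
    where
    gt : GTRows (gtOfState s)
    gt = subst GTRows (sym e) (chain⇒gtRows _ rest (subst (λ p → Linked Interleave (p ++ [ [] ])) e (gtChain adm)))
    strict : All (Linked _>ℤ_) (gtOfState s)
    strict = subst (All _) (sym (Vecₚ.toList-map colsDesc (Vec.init (ver s))))
                   (All.map⁺ (All.universal colsDesc-sorted _))

  states→patterns-injective : ∀ s s' → Admissible lam s → Admissible lam s' → gtOfState s ≡ gtOfState s' → s ≡ s'
  states→patterns-injective s s' adm adm' e = cong₂ mkState hor≡ ver≡
    where
    ver≡ : ver s ≡ ver s'
    ver≡ = toList-injective (Listₚ.map-injective colsDesc-injective (begin
      rowSets (ver s)        ≡⟨ rowSets-state adm ⟩
      gtOfState s ++ [ [] ]  ≡⟨ cong (_++ [ [] ]) e ⟩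
      gtOfState s' ++ [ [] ] ≡⟨ rowSets-state adm' ⟨
      rowSets (ver s')       ∎))
    hor≡ : hor s ≡ hor s'
    hor≡ = trans (hor-forced adm) (trans (cong forcedHor ver≡) (sym (hor-forced adm')))

  chain⇒admissible : (W : Vec (Vec Spin N) (suc n)) → Linked Interleave (rowSets W) →
                     colsDesc (lookup W fz) ≡ lamRhoℤ lam → colsDesc (lookup W (fromℕ n)) ≡ [] →
                     Admissible lam (mkState (forcedHor W) W)
  chain⇒admissible W chain top bottom = record
    { vertices   = λ i → row⇒pointwise _ _ _ (proj₁ (forced i))
    ; leftBdry   = λ i → proj₂ (proj₂ (forced i))
    ; rightBdry  = λ i → proj₁ (proj₂ (forced i))
    ; bottomBdry = colsDesc≡[]⇒plus (lookup W (fromℕ n)) bottom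
    ; topBdry    = lamRho⇒top (lookup W fz) top
    }
    where
    forced : ∀ i → Row (lookup (forcedHor W) i) (lookup W (inject₁ i)) (lookup W (fs i))
                 × Boundary (lookup (forcedHor W) i)
    forced i = subst (λ hv → Row hv t b × Boundary hv) (sym (Vecₚ.lookup∘tabulate _ i))
                     (interleave⇒row t b (rowSets-linked⁻ W chain i))
      where
      t = lookup W (inject₁ i)
      b = lookup W (fs i)

  states→patterns-surjective : ∀ p → IsStrictGTTop (lamRhoℤ lam) p → ∃ λ s → Admissible lam s × gtOfState s ≡ p
  states→patterns-surjective p pat@(gt , _ , rest , refl) = s , adm , gtOfState≡p
    where
    len : length (p ++ [ [] ]) ≡ suc n
    len = trans (Listₚ.length-++ p) (trans (+-comm (length p) 1)
                (cong suc (trans (pattern-length pat) (lamRhoℤ-length lam))))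
    -- one line of vertical spins for each row of p, and an all-+ line below them
    V = listToVec (p ++ [ [] ]) len
    W = Vec.map (minusVec N) V
    s = mkState (forcedHor W) W
    sets : rowSets W ≡ p ++ [ [] ]
    sets = begin
      map colsDesc (Vec.toList W)                    ≡⟨ cong (map colsDesc) (Vecₚ.toList-map (minusVec N) V) ⟩
      map colsDesc (map (minusVec N) (Vec.toList V)) ≡⟨ cong (map colsDesc ∘ map (minusVec N)) (toList-listToVec _ len) ⟩
      map colsDesc (map (minusVec N) (p ++ [ [] ]))  ≡⟨ Listₚ.map-∘ (p ++ [ [] ]) ⟨
      map (colsDesc ∘ minusVec N) (p ++ [ [] ])      ≡⟨ Listₚ.map-id-local (All.map colsDesc-minusVec rows) ⟩
      p ++ [ [] ]                                    ∎
      where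
      rows = pattern-rows (lamRhoℤ-strictRow lam part) pat
    adm : Admissible lam s
    adm = chain⇒admissible W (subst (Linked Interleave) (sym sets) (gtRows⇒chain gt))
            (rowSets-head W sets) (rowSets-last W p sets)
    gtOfState≡p : gtOfState s ≡ p
    gtOfState≡p = Listₚ.++-cancelʳ [ [] ] (gtOfState s) p (trans (sym (rowSets-state adm)) sets)

module _ {A : Set} where

  nth-∈ : ∀ {L : List A} r {x} → nth L r ≡ just x → x ∈ L
  nth-∈ {y ∷ L} zero    refl = here refl
  nth-∈ {y ∷ L} (suc r) e    = there (nth-∈ {L} r e)

  nth-< : ∀ {L : List A} r {x} → nth L r ≡ just x → r < length L
  nth-< {y ∷ L} zero    _ = s≤s z≤n
  nth-< {y ∷ L} (suc r) e = s≤s (nth-< {L} r e)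

  nth-all : {P : A → Set} {L : List A} → All P L → ∀ r {x} → nth L r ≡ just x → P x
  nth-all pL r e = All.lookup pL (nth-∈ r e)

  all-from-nth : {P : A → Set} (L : List A) → (∀ r x → nth L r ≡ just x → P x) → All P L
  all-from-nth []      _ = []
  all-from-nth (x ∷ L) p = p 0 x refl ∷ all-from-nth L (λ r → p (suc r))

  nth-linked : {R : A → A → Set} {L : List A} → Linked R L → ∀ r {x y} →
               nth L r ≡ just x → nth L (suc r) ≡ just y → R x y
  nth-linked (xy ∷ _)    zero    refl refl = xy
  nth-linked (_ ∷ rest)  (suc r) e    e'   = nth-linked rest r e e'

  linked-from-nth : {R : A → A → Set} (L : List A) →
                    (∀ r x y → nth L r ≡ just x → nth L (suc r) ≡ just y → R x y) → Linked R L
  linked-from-nth []          _ = []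
  linked-from-nth (x ∷ [])    _ = [-]
  linked-from-nth (x ∷ y ∷ L) p = p 0 x y refl refl ∷ linked-from-nth (y ∷ L) (λ r → p (suc r))

  nth-last : (L : List A) (x : A) → nth (L ++ [ x ]) (length L) ≡ just x
  nth-last []      x = refl
  nth-last (_ ∷ L) x = nth-last L x

  nth-reverse-head : (x : A) (xs : List A) → nth (reverse (x ∷ xs)) (length xs) ≡ just x
  nth-reverse-head x xs = begin
    nth (reverse (x ∷ xs)) (length xs)           ≡⟨ cong (λ q → nth q (length xs)) (Listₚ.unfold-reverse x xs) ⟩
    nth (reverse xs ++ [ x ]) (length xs)        ≡⟨ cong (nth (reverse xs ++ [ x ])) (Listₚ.length-reverse xs) ⟨
    nth (reverse xs ++ [ x ]) (length (reverse xs)) ≡⟨ nth-last (reverse xs) x ⟩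
    just x                                       ∎

  nth-last⁻ : ∀ {k x} (L : List A) → length L ≡ suc k → nth L k ≡ just x → ∃ λ init → L ≡ init ++ [ x ]
  nth-last⁻ (y ∷ [])               refl refl = [] , refl
  nth-last⁻ {k = suc k} (y ∷ z ∷ L) len  e    with nth-last⁻ (z ∷ L) (suc-injective len) e
  ... | init , L≡ = y ∷ init , cong (y ∷_) L≡

  nth-map : {B : Set} (f : A → B) (L : List A) (r : ℕ) → nth (map f L) r ≡ Maybe.map f (nth L r)
  nth-map f []      r       = refl
  nth-map f (x ∷ L) zero    = refl
  nth-map f (x ∷ L) (suc r) = nth-map f L r

entry-at : ∀ T r c {col} → nth T c ≡ just col → entry T r c ≡ nth col r
entry-at T r c e rewrite e = refl

entry-split : ∀ T r c {x} → entry T r c ≡ just x → ∃ λ col → nth T c ≡ just col × nth col r ≡ just x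
entry-split T r c e with nth T c
... | just col = col , refl , e

alt-nth : ∀ {xs ys} → Alt R xs ys → ∀ r {x y} → nth xs r ≡ just x → nth ys r ≡ just y → R x y
alt-nth (alt-cons xy _ _)   zero    refl refl = xy
alt-nth (alt-cons _ _ rest) (suc r) e    e'   = alt-nth rest r e e'

alt-nth-diagonal : ∀ {xs ys} → Alt R xs ys → ∀ r {x y} → nth xs (suc r) ≡ just x → nth ys r ≡ just y → R y x
alt-nth-diagonal (alt-cons _ yx _)  zero    refl refl = yx
alt-nth-diagonal (alt-cons _ _ rest) (suc r) e    e'   = alt-nth-diagonal rest r e e'

alt-from-nth : ∀ xs ys → length xs ≡ suc (length ys) →
               (∀ r x y → nth xs r ≡ just x → nth ys r ≡ just y → R x y) →
               (∀ r x y → nth xs (suc r) ≡ just x → nth ys r ≡ just y → R y x) → Alt R xs ys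
alt-from-nth (x ∷ [])      []       _ _ _ = alt-one
alt-from-nth (x ∷ x' ∷ xs) (y ∷ ys) e p q =
  alt-cons (p 0 x y refl refl) (q 0 x' y refl refl)
           (alt-from-nth (x' ∷ xs) ys (suc-injective e) (λ r → p (suc r)) (λ r → q (suc r)))

chain-column-length : ∀ {L X T} → Linked (Alt R) (X ∷ T) → length X ≡ L →
                      ∀ c {col} → nth (X ∷ T) c ≡ just col → length col ≡ L ∸ c
chain-column-length _               lenX zero    refl = lenX
chain-column-length {L = L} (alt ∷ rest) lenX (suc c) e =
  trans (chain-column-length rest (cong (_∸ 1) (trans (sym (alt-length alt)) lenX)) c e) (∸-+-assoc L 1 c)

module _ {n lam1 M : ℕ} (M≡ : M ≡ lam1 + n) where

  columns⇒staircase : ∀ c cs → length cs ≡ n → length c ≡ M → Linked (Alt _≤_) (c ∷ cs) →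
                      All (Column M) (c ∷ cs) → IsStaircase n lam1 (c ∷ cs)
  columns⇒staircase c cs lencs lenc alts cols = record
    { numCols   = cong suc lencs
    ; colLen    = λ k col e → chain-column-length alts (trans lenc M≡) k e
    ; range     = λ r k x e → let col , e₁ , e₂ = entry-split T r k e in
                    subst (λ m → InRange m x) M≡ (All.lookup (proj₂ (nth-all cols k e₁)) (nth-∈ r e₂))
    ; rowWeak   = λ r k x y e e' → let X , e₁ , e₂ = entry-split T r k e
                                       Y , f₁ , f₂ = entry-split T r (suc k) e' in
                    alt-nth (nth-linked alts k e₁ f₁) r e₂ f₂
    ; colStrict = λ r k x y e e' → let X , e₁ , e₂ = entry-split T r k e in
                    nth-linked (proj₁ (nth-all cols k e₁)) r e₂ (trans (sym (entry-at T (suc r) k e₁)) e')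
    ; diagonal  = λ r k x y e e' → let X , e₁ , e₂ = entry-split T (suc r) k e
                                       Y , f₁ , f₂ = entry-split T r (suc k) e' in
                    alt-nth-diagonal (nth-linked alts k e₁ f₁) r e₂ f₂
    }
    where T = c ∷ cs

  staircase⇒columns : ∀ T → IsStaircase n lam1 T → Linked (Alt _≤_) T × All (Column M) T
  staircase⇒columns T st = alts , cols
    where
    open IsStaircase st
    one-longer : ∀ k {X Y} → nth T k ≡ just X → nth T (suc k) ≡ just Y → length X ≡ suc (length Y)
    one-longer k {X} {Y} e₁ e₂ with subst (suc k <_) numCols (nth-< {L = T} (suc k) e₂)
    ... | s≤s k<n = begin
      length X               ≡⟨ colLen k X e₁ ⟩
      (lam1 + n) ∸ k         ≡⟨ +-∸-assoc 1 (≤-trans k<n (m≤n+m n lam1)) ⟩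
      suc (lam1 + n ∸ suc k) ≡⟨ cong suc (colLen (suc k) Y e₂) ⟨
      suc (length Y)         ∎
    alts : Linked (Alt _≤_) T
    alts = linked-from-nth T λ k X Y e₁ e₂ →
      alt-from-nth X Y (one-longer k e₁ e₂)
        (λ r x y a b → rowWeak r k x y (trans (entry-at T r k e₁) a) (trans (entry-at T r (suc k) e₂) b))
        (λ r x y a b → diagonal r k x y (trans (entry-at T (suc r) k e₁) a) (trans (entry-at T r (suc k) e₂) b))
    cols : All (Column M) T
    cols = all-from-nth T λ k X e →
      linked-from-nth X (λ r x y e₁ e₂ →
        colStrict r k x y (trans (entry-at T r k e) e₁) (trans (entry-at T (suc r) k e) e₂)) ,
      all-from-nth X (λ r x e₁ → subst (λ m → InRange m x) (sym M≡) (range r k x (trans (entry-at T r k e) e₁)))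

module PatternsToStaircases {n : ℕ} (lam : Vec ℕ n) (part : IsPartition lam) where

  N : ℕ
  N = n + first lam

  -- IsStaircase measures the columns by λ₁ + n.
  N≡ : N ≡ first lam + n
  N≡ = +-comm n (first lam)

  ComplOfLamRho : List ℕ → Set
  ComplOfLamRho col = ∀ x → (x ∈ col → 1 ≤ x × x ≤ N × x ∉ lamRho lam)
                          × (1 ≤ x × x ≤ N × x ∉ lamRho lam → x ∈ col)

  compl-lamRho : ComplOfLamRho (compl N (lamRhoℤ lam))
  compl-lamRho x = (λ x∈ → let (lo , hi) , x∉ = ∈compl⁻ x∈ in lo , hi , λ x∈ρ → x∉ (∈-map⁺ +_ x∈ρ)) ,
                   (λ (lo , hi , x∉) → ∈compl⁺ (lo , hi) (x∉ ∘ ∈lamRhoℤ⁻ lam))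

  complOfLamRho-unique : ∀ {col} → Linked _<_ col → ComplOfLamRho col → col ≡ compl N (lamRhoℤ lam)
  complOfLamRho-unique {col} sorted spec =
    sorted-unique <-trans (<-irrefl refl) sorted (compl-sorted {N} {lamRhoℤ lam})
      (λ {x} x∈ → proj₂ (compl-lamRho x) (proj₁ (spec x) x∈))
      (λ {x} x∈ → proj₂ (spec x) (proj₁ (compl-lamRho x) x∈))

  rows↑ : ∀ {p} → IsStrictGTTop (lamRhoℤ lam) p → All (StrictRow N) ([] ∷ reverse p)
  rows↑ {p} pat = subst (All (StrictRow N)) (Listₚ.reverse-++ p [ [] ])
                        (all-reverse (pattern-rows (lamRhoℤ-strictRow lam part) pat))

  chain↑ : ∀ {p} → IsStrictGTTop (lamRhoℤ lam) p → Linked (flip Interleave) ([] ∷ reverse p)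
  chain↑ {p} (gt , _) =
    subst (Linked (flip Interleave)) (Listₚ.reverse-++ p [ [] ]) (linked-reverse (gtRows⇒chain gt))

  filling-last : ∀ top rest → nth (fillingOf N (top ∷ rest)) (length (top ∷ rest)) ≡ just (compl N top)
  filling-last top rest =
    trans (nth-map (compl N) (reverse (top ∷ rest)) (length rest))
          (cong (Maybe.map (compl N)) (nth-reverse-head top rest))

  patterns→staircases : ∀ p → IsStrictGTTop (lamRhoℤ lam) p → IsStaircaseRC lam (fillingOf N p)
  patterns→staircases p pat@(_ , _ , rest , refl) = staircase , compl N (lamRhoℤ lam) , last , compl-lamRho
    where
    len : length p ≡ n
    len = trans (pattern-length pat) (lamRhoℤ-length lam)
    staircase : IsStaircase n (first lam) (fillingOf N p)
    staircase = columns⇒staircase N≡ (compl N []) (map (compl N) (reverse p))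
      (trans (Listₚ.length-map _ (reverse p)) (trans (Listₚ.length-reverse p) len))
      compl-[]-length
      (Linked.map⁺ (linked-map-all (λ row row' i → compl-interleave row' row i) (rows↑ pat) (chain↑ pat)))
      (All.map⁺ (All.universal (λ r → compl-column {N} {r}) _))
    last : nth (fillingOf N p) n ≡ just (compl N (lamRhoℤ lam))
    last = subst (λ k → nth (fillingOf N p) k ≡ just (compl N (lamRhoℤ lam))) len (filling-last _ rest)

  patterns→staircases-injective : ∀ p p' → IsStrictGTTop (lamRhoℤ lam) p → IsStrictGTTop (lamRhoℤ lam) p' →
                                  fillingOf N p ≡ fillingOf N p' → p ≡ p'
  patterns→staircases-injective p p' pat pat' e = Listₚ.reverse-injective (begin
    reverse p                                  ≡⟨ recover pat ⟨
    map (coCol N) (map (compl N) (reverse p))  ≡⟨ cong (map (coCol N)) (Listₚ.∷-injectiveʳ e) ⟩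
    map (coCol N) (map (compl N) (reverse p')) ≡⟨ recover pat' ⟩
    reverse p'                                 ∎)
    where
    recover : ∀ {q} → IsStrictGTTop (lamRhoℤ lam) q → map (coCol N) (map (compl N) (reverse q)) ≡ reverse q
    recover {q} pat = trans (sym (Listₚ.map-∘ (reverse q)))
                            (Listₚ.map-id-local (All.map coCol-compl (All.tail (rows↑ pat))))

  patternOf : List (List ℕ) → List (List ℤ)
  patternOf cs = reverse (map (coCol N) cs)

  module _ {c₀ cs} (alts : Linked (Alt _≤_) (c₀ ∷ cs)) (cols : All (Column N) (c₀ ∷ cs))
           (first-empty : coCol N c₀ ≡ []) where

    private
      rows : map (coCol N) (c₀ ∷ cs) ≡ [] ∷ reverse (patternOf cs)
      rows = cong₂ _∷_ first-empty (sym (Listₚ.reverse-involutive (map (coCol N) cs)))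

    patternOf-chain : Linked Interleave (patternOf cs ++ [ [] ])
    patternOf-chain = subst (Linked Interleave) (begin
      reverse (map (coCol N) (c₀ ∷ cs))         ≡⟨ cong reverse rows ⟩
      reverse ([] ∷ reverse (patternOf cs))     ≡⟨ Listₚ.unfold-reverse [] (reverse (patternOf cs)) ⟩
      reverse (reverse (patternOf cs)) ++ [ [] ] ≡⟨ cong (_++ [ [] ]) (Listₚ.reverse-involutive (patternOf cs)) ⟩
      patternOf cs ++ [ [] ]                    ∎)
      (linked-reverse (Linked.map⁺ (linked-map-all (λ col col' alt → coCol-interleave col col' alt) cols alts)))

    filling-patternOf : fillingOf N (patternOf cs) ≡ c₀ ∷ cs
    filling-patternOf = begin
      map (compl N) ([] ∷ reverse (patternOf cs)) ≡⟨ cong (map (compl N)) rows ⟨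
      map (compl N) (map (coCol N) (c₀ ∷ cs))     ≡⟨ Listₚ.map-∘ (c₀ ∷ cs) ⟨
      map (compl N ∘ coCol N) (c₀ ∷ cs)           ≡⟨ Listₚ.map-id-local (All.map compl-coCol cols) ⟩
      c₀ ∷ cs                                     ∎

  patternOf-top : ∀ init {col} → col ≡ compl N (lamRhoℤ lam) →
                  patternOf (init ++ [ col ]) ≡ lamRhoℤ lam ∷ patternOf init
  patternOf-top init {col} refl = begin
    reverse (map (coCol N) (init ++ [ col ]))       ≡⟨ cong reverse (Listₚ.map-++ (coCol N) init [ col ]) ⟩
    reverse (map (coCol N) init ++ [ coCol N col ]) ≡⟨ Listₚ.reverse-++ (map (coCol N) init) _ ⟩
    coCol N col ∷ patternOf init
      ≡⟨ cong (_∷ patternOf init) (coCol-compl (lamRhoℤ-strictRow lam part)) ⟩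
    lamRhoℤ lam ∷ patternOf init                    ∎

  patterns→staircases-surjective : 1 ≤ n → ∀ T → IsStaircaseRC lam T →
                                   ∃ λ p → IsStrictGTTop (lamRhoℤ lam) p × fillingOf N p ≡ T
  patterns→staircases-surjective 1≤n [] (st , _) with () ← IsStaircase.numCols st
  patterns→staircases-surjective (s≤s z≤n) (c₀ ∷ cs) (st , col , nth-col , col-spec)
    with nth-last⁻ cs (suc-injective (IsStaircase.numCols st)) nth-col
  ... | init , refl =
    patternOf cs , (gt , strict , _ , top) , filling-patternOf alts cols first-empty
    where
    alts = proj₁ (staircase⇒columns N≡ (c₀ ∷ cs) st)
    cols = proj₂ (staircase⇒columns N≡ (c₀ ∷ cs) st)
    -- the first column is full, so its complementary row is empty
    first-empty : coCol N c₀ ≡ []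
    first-empty = coCol-full (All.head cols) (trans (IsStaircase.colLen st 0 c₀ refl) (sym N≡))
    top : patternOf cs ≡ lamRhoℤ lam ∷ patternOf init
    top = patternOf-top init (complOfLamRho-unique (proj₁ (All.lookup cols (there (∈-++⁺ʳ init (here refl))))) col-spec)
    gt : GTRows (patternOf cs)
    gt = subst GTRows (sym top)
           (chain⇒gtRows _ _ (subst (λ q → Linked Interleave (q ++ [ [] ])) top (patternOf-chain alts cols first-empty)))
    strict : All (Linked _>ℤ_) (patternOf cs)
    strict = all-reverse (All.map⁺ (All.universal (λ c → colsDesc-sorted (plusVec N c)) cs))

mainTheorem6 : (n : ℕ) → 1 ≤ n → (lam : Vec ℕ n) → IsPartition lam →
    BijectionOnto (Admissible lam) (IsStrictGTTop (lamRhoℤ lam)) gtOfState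
    × BijectionOnto (IsStrictGTTop (lamRhoℤ lam)) (IsStaircaseRC lam) (fillingOf (n + first lam))
mainTheorem6 n 1≤n lam part =
  record { mapsTo     = states→patterns 1≤n
         ; injective  = states→patterns-injective
         ; surjective = states→patterns-surjective } ,
  record { mapsTo     = patterns→staircases
         ; injective  = patterns→staircases-injective
         ; surjective = patterns→staircases-surjective 1≤n }
  where
  open StatesToPatterns lam part
  open PatternsToStaircases lam part
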